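{- Let $s\ge 2$ and let $G=K(n_1,\dots,n_s)$ be a complete $s$-partite graph with parts $V_1,\dots,V_s$. Let $j\in\{1,\dots,s\}$. If $n_j\ge 6$, then $\chi_3(G)=\chi_3(G-V_j)+1$.
   Context: $K(n_1,\dots,n_s)$ denotes the complete $s$-partite graph whose parts $V_1,\dots,V_s$ have $n_1,\dots,n_s$ vertices; $G-V_j$ is obtained by deleting the vertices of $V_j$. A $3$-relaxed $k$-coloring is a map $f:V\to\{1,\dots,k\}$ such that every vertex $u$ has at most $3$ neighbors $v$ with $f(v)=f(u)$; $\chi_3(G)$ is the minimum such $k$. -}

module Defs where

open import Data.Nat using (ℕ; zero; suc; _≤_; _<_; _∸_)
open import Data.Fin using (Fin; punchIn)
open import Data.Fin.Properties using (_≟_)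
open import Data.Product using (Σ; _,_; proj₁; _×_)
open import Data.List using (List; length; filter; concatMap; allFin; map)
open import Relation.Nullary using (¬_; Dec; yes; no)
open import Relation.Nullary.Decidable using (_×-dec_; ¬?)

record FinGraph : Set₁ where
  field
    V    : Set
    vs   : List V                      -- enumeration of all vertices, each once
    Adj  : V → V → Set
    adj? : (u v : V) → Dec (Adj u v)

open FinGraph public

K : (s : ℕ) → (Fin s → ℕ) → FinGraph
K s n = record
  { V    = Σ (Fin s) (λ i → Fin (n i))
  ; vs   = concatMap (λ i → map (λ a → (i , a)) (allFin (n i))) (allFin s)
  ; Adj  = λ u v → ¬ (proj₁ u ≡ proj₁ v)
  ; adj? = λ u v → ¬? (proj₁ u ≟ proj₁ v)
  }
  where open import Relation.Binary.PropositionalEquality using (_≡_)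

-- K(n_1,...,n_s) - V_j  is  K(n_1,...,n_{j-1},n_{j+1},...,n_s)  (s = suc t).
deletePart : (t : ℕ) → (Fin (suc t) → ℕ) → Fin (suc t) → (Fin t → ℕ)
deletePart t n j i = n (punchIn j i)

sameColourNbrs : (G : FinGraph) {k : ℕ} → (V G → Fin k) → V G → ℕ
sameColourNbrs G f u =
  length (filter (λ v → adj? G u v ×-dec (f v ≟ f u)) (vs G))

Relaxed3Colouring : (G : FinGraph) (k : ℕ) → (V G → Fin k) → Set
Relaxed3Colouring G k f = ∀ u → sameColourNbrs G f u ≤ 3

Colourable3 : FinGraph → ℕ → Set
Colourable3 G k = Σ (V G → Fin k) (Relaxed3Colouring G k)

IsChi3 : FinGraph → ℕ → Set
IsChi3 G k = Colourable3 G k × (∀ m → m < k → ¬ Colourable3 G m)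

-- Colouring V_j with one fresh colour gives χ₃(G) ≤ χ₃(G − V_j) + 1.  Conversely, let f be a
-- 3-relaxed (m+1)-colouring of G, H = G − V_j, and a(d) the number of vertices of V_j coloured d.
-- Every vertex of H is adjacent to all of V_j, so a vertex of H coloured d has at most 3 − a(d)
-- neighbours of its colour in H, and a colour with a(d) > 0 occurs at most 3 times on H.  We free
-- one colour c on H: either the vertices of H coloured c are sent to distinct other colours used
-- on V_j, each of which can absorb one more same-coloured neighbour; or V_j uses only two or three
-- colours whose classes on H are too large for that, and then |V_j| ≥ 6 forces two of them to have
-- 2 a(d) + |class of d in H| ≥ 7, which makes both classes independent in the multipartite graph H,
-- so one can be merged into the other.

module Submission where

open import Defs
open import Data.Nat using (ℕ; zero; suc; _+_; _≤_; _<_; z≤n; s≤s; s≤s⁻¹; _≤?_)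
open import Data.Nat.Properties hiding (_≟_)

open import Data.Fin as Fin using (Fin; punchIn; punchOut; inject≤; inject₁; fromℕ)
open import Data.Fin.Properties
  using (_≟_; any?; ¬Fin0; punchIn-injective; punchInᵢ≢i; punchIn-punchOut; punchOut-injective;
         inject≤-injective; inject₁-injective; fromℕ≢inject₁)
open import Data.List using (List; []; _∷_; length; filter; map; concat; tabulate; allFin; lookup; _++_)
open import Data.List.Properties
  using (filter-++; length-++; filter-none; filter-all; filter-some; map-tabulate; length-tabulate; length-map)
open import Data.List.Membership.Propositional using (_∈_; lose)
open import Data.List.Membership.Propositional.Properties
  using (∈-filter⁺; ∈-lookup; ∈-allFin; ∈-map⁺; ∈-map⁻; ∈-concat⁺′)
open import Data.List.Membership.Setoid.Properties using (index-injective)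
open import Data.List.Relation.Unary.All as All using (All; []; _∷_; universal)
open import Data.List.Relation.Unary.All.Properties using (all-filter) renaming (map⁺ to All-map⁺)
open import Data.List.Relation.Unary.AllPairs as AllPairs using ([]; _∷_)
open import Data.List.Relation.Unary.AllPairs.Properties using () renaming (map⁺ to AllPairs-map⁺)
open import Data.List.Relation.Unary.Any using (index)
open import Data.List.Relation.Unary.Unique.Propositional using (Unique)
open import Data.List.Relation.Unary.Unique.Propositional.Properties
  using (allFin⁺; concat⁺; filter⁺) renaming (map⁺ to Unique-map⁺)
open import Data.Product using (∃; _×_; _,_; proj₁; proj₂)
open import Data.Sum using (_⊎_; inj₁; inj₂)
open import Data.Empty using (⊥; ⊥-elim)
open import Function using (_∘_; case_of_)
open import Level using (0ℓ)
open import Relation.Binary.PropositionalEquality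
open import Relation.Nullary using (¬_; Dec; yes; no; contradiction)
open import Relation.Nullary.Decidable using (_×-dec_; _⊎-dec_; ¬?; decidable-stable)
open import Relation.Unary using (Pred; Decidable; _⊆_; _∪_)
open import Relation.Unary.Properties using (U?; _∪?_)
open import Algebra.Properties.CommutativeSemigroup +-commutativeSemigroup using (interchange)
open import Algebra.Properties.CommutativeMonoid.Sum +-0-commutativeMonoid
  using (sum-syntax; sum-remove; sum-cong-≋)

6≤m+n⇒n≤3⇒3≤m : ∀ {m n} → 6 ≤ m + n → n ≤ 3 → 3 ≤ m
6≤m+n⇒n≤3⇒3≤m {m} {n} 6≤m+n n≤3 = +-cancelʳ-≤ n 3 m (≤-trans (+-monoʳ-≤ 3 n≤3) 6≤m+n)

2≰n⇒n≤1 : ∀ {n} → ¬ 2 ≤ n → n ≤ 1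
2≰n⇒n≤1 2≰n = s≤s⁻¹ (≰⇒> 2≰n)

6≰5 : ¬ 6 ≤ 5
6≰5 (s≤s (s≤s (s≤s (s≤s (s≤s ())))))

two-of-three : ∀ {x y z} → 6 ≤ x + (y + z) → x ≤ 3 → y ≤ 3 → z ≤ 3 →
               (2 ≤ x × 2 ≤ y) ⊎ (2 ≤ x × 2 ≤ z) ⊎ (2 ≤ y × 2 ≤ z)
two-of-three {x} {y} {z} 6≤sum x≤3 y≤3 z≤3 with 2 ≤? x | 2 ≤? y | 2 ≤? z
... | yes 2≤x | yes 2≤y | _       = inj₁ (2≤x , 2≤y)
... | yes 2≤x | no  _   | yes 2≤z = inj₂ (inj₁ (2≤x , 2≤z))
... | no  _   | yes 2≤y | yes 2≤z = inj₂ (inj₂ (2≤y , 2≤z))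
... | _       | no  2≰y | no  2≰z =
  ⊥-elim (6≰5 (≤-trans 6≤sum (+-mono-≤ x≤3 (+-mono-≤ (2≰n⇒n≤1 2≰y) (2≰n⇒n≤1 2≰z)))))
... | no  2≰x | _       | no  2≰z =
  ⊥-elim (6≰5 (≤-trans 6≤sum (+-mono-≤ (2≰n⇒n≤1 2≰x) (+-mono-≤ y≤3 (2≰n⇒n≤1 2≰z)))))
... | no  2≰x | no  2≰y | _       =
  ⊥-elim (6≰5 (≤-trans 6≤sum (+-mono-≤ (2≰n⇒n≤1 2≰x) (+-mono-≤ (2≰n⇒n≤1 2≰y) z≤3))))

m≤1⇒m≤n : ∀ {m n} → m ≤ 1 → (1 ≤ m → 1 ≤ n) → m ≤ n
m≤1⇒m≤n {zero}        _        _   = z≤n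
m≤1⇒m≤n {suc zero}    _        pos = pos ≤-refl
m≤1⇒m≤n {suc (suc _)} (s≤s ()) _

dec-⊎ : ∀ {P Q : Set} → Dec P → Dec Q → ¬ (¬ P × ¬ Q) → P ⊎ Q
dec-⊎ (yes p) _       _        = inj₁ p
dec-⊎ (no _)  (yes q) _        = inj₂ q
dec-⊎ (no ¬p) (no ¬q) ¬neither = contradiction (¬p , ¬q) ¬neither

count : {A : Set} {P : Pred A 0ℓ} → Decidable P → List A → ℕ
count P? xs = length (filter P? xs)

module _ {A : Set} where

  count-mono : ∀ {P Q : Pred A 0ℓ} (P? : Decidable P) (Q? : Decidable Q) →
               P ⊆ Q → ∀ xs → count P? xs ≤ count Q? xs
  count-mono P? Q? P⊆Q [] = z≤n
  count-mono P? Q? P⊆Q (x ∷ xs) with P? x | Q? x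
  ... | yes _  | yes _  = s≤s (count-mono P? Q? P⊆Q xs)
  ... | yes px | no ¬qx = contradiction (P⊆Q px) ¬qx
  ... | no _   | yes _  = m≤n⇒m≤1+n (count-mono P? Q? P⊆Q xs)
  ... | no _   | no _   = count-mono P? Q? P⊆Q xs

  count-∪ : ∀ {P Q : Pred A 0ℓ} (P? : Decidable P) (Q? : Decidable Q) →
            ∀ xs → count (P? ∪? Q?) xs ≤ count P? xs + count Q? xs
  count-∪ P? Q? [] = z≤n
  count-∪ P? Q? (x ∷ xs) with P? x | Q? x
  ... | yes _ | yes _ = s≤s (≤-trans (count-∪ P? Q? xs) (+-monoʳ-≤ _ (n≤1+n _)))
  ... | yes _ | no _  = s≤s (count-∪ P? Q? xs)
  ... | no _  | yes _ = ≤-trans (s≤s (count-∪ P? Q? xs)) (≤-reflexive (sym (+-suc _ _)))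
  ... | no _  | no _  = count-∪ P? Q? xs

  count-⊆∪ : ∀ {P Q R : Pred A 0ℓ} (P? : Decidable P) (Q? : Decidable Q) (R? : Decidable R) →
             P ⊆ Q ∪ R → ∀ xs → count P? xs ≤ count Q? xs + count R? xs
  count-⊆∪ P? Q? R? P⊆Q∪R xs = ≤-trans (count-mono P? (Q? ∪? R?) P⊆Q∪R xs) (count-∪ Q? R? xs)

  count-U : ∀ xs → count (U? {A = A}) xs ≡ length xs
  count-U xs = cong length (filter-all U? (universal _ xs))

  count-≡0 : ∀ {P : Pred A 0ℓ} (P? : Decidable P) → (∀ x → ¬ P x) → ∀ xs → count P? xs ≡ 0
  count-≡0 P? ¬P xs = cong length (filter-none P? (universal ¬P xs))

  count-pos : ∀ {P : Pred A 0ℓ} (P? : Decidable P) {x xs} → x ∈ xs → P x → 1 ≤ count P? xs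
  count-pos P? x∈xs px = filter-some P? (lose x∈xs px)

  count-witness : ∀ {P : Pred A 0ℓ} (P? : Decidable P) xs → 1 ≤ count P? xs → ∃ P
  count-witness P? (x ∷ xs) pos with P? x
  ... | yes px = x , px
  ... | no _   = count-witness P? xs pos

  count-≤1 : ∀ {P : Pred A 0ℓ} (P? : Decidable P) → (∀ {x y} → P x → P y → x ≡ y) →
             ∀ {xs} → Unique xs → count P? xs ≤ 1
  count-≤1 {P} P? P-unique {xs} xs-unique = length≤1 (filter⁺ P? xs-unique) (all-filter P? xs)
    where
    length≤1 : ∀ {ys} → Unique ys → All P ys → length ys ≤ 1
    length≤1 []                  _             = z≤n
    length≤1 (_ ∷ [])            _             = s≤s z≤n
    length≤1 ((x≢y ∷ _) ∷ _ ∷ _) (px ∷ py ∷ _) = contradiction (P-unique px py) x≢y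

  count-++ : ∀ {P : Pred A 0ℓ} (P? : Decidable P) xs ys → count P? (xs ++ ys) ≡ count P? xs + count P? ys
  count-++ P? xs ys = trans (cong length (filter-++ P? xs ys)) (length-++ (filter P? xs))

  count-concat-tabulate : ∀ {P : Pred A 0ℓ} (P? : Decidable P) {s} (f : Fin s → List A) →
                          count P? (concat (tabulate f)) ≡ ∑[ i < s ] count P? (f i)
  count-concat-tabulate P? {zero}  f = refl
  count-concat-tabulate P? {suc s} f =
    trans (count-++ P? (f Fin.zero) _) (cong (count P? (f Fin.zero) +_) (count-concat-tabulate P? (f ∘ Fin.suc)))

module _ {A B : Set} where

  count-map : ∀ {P : Pred B 0ℓ} (P? : Decidable P) (g : A → B) xs → count P? (map g xs) ≡ count (P? ∘ g) xs
  count-map P? g [] = refl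
  count-map P? g (x ∷ xs) with P? (g x)
  ... | yes _ = cong suc (count-map P? g xs)
  ... | no _  = count-map P? g xs

lookup-injective : ∀ {A : Set} {xs : List A} → Unique xs → ∀ {i j} → lookup xs i ≡ lookup xs j → i ≡ j
lookup-injective (_   ∷ _) {Fin.zero}  {Fin.zero}  _  = refl
lookup-injective (x∉ ∷ _) {Fin.zero}  {Fin.suc j} eq = contradiction eq (All.lookup x∉ (∈-lookup j))
lookup-injective (x∉ ∷ _) {Fin.suc i} {Fin.zero}  eq = contradiction (sym eq) (All.lookup x∉ (∈-lookup i))
lookup-injective (_  ∷ u) {Fin.suc i} {Fin.suc j} eq = cong Fin.suc (lookup-injective u eq)

module _ {s : ℕ} {n : Fin s → ℕ} where

  part : (i : Fin s) → List (V (K s n))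
  part i = map (i ,_) (allFin (n i))

  ∈-vertices : ∀ v → v ∈ vs (K s n)
  ∈-vertices (i , a) = ∈-concat⁺′ (∈-map⁺ (i ,_) (∈-allFin a)) (∈-map⁺ part (∈-allFin i))

  vertices-unique : Unique (vs (K s n))
  vertices-unique =
    concat⁺ (All-map⁺ (universal (λ i → Unique-map⁺ (λ { refl → refl }) (allFin⁺ (n i))) (allFin s)))
            (AllPairs-map⁺ (AllPairs.map parts-disjoint (allFin⁺ s)))
    where
    parts-disjoint : ∀ {i i′} → i ≢ i′ → ∀ {v} → v ∈ part i × v ∈ part i′ → ⊥
    parts-disjoint i≢i′ (v∈i , v∈i′) with ∈-map⁻ (_ ,_) v∈i | ∈-map⁻ (_ ,_) v∈i′
    ... | _ , _ , refl | _ , _ , refl = i≢i′ refl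

  count-vertices : ∀ {P : Pred (V (K s n)) 0ℓ} (P? : Decidable P) →
                   count P? (vs (K s n)) ≡ ∑[ i < s ] count (λ a → P? (i , a)) (allFin (n i))
  count-vertices P? = begin
    count P? (concat (map part (allFin s)))  ≡⟨ cong (count P? ∘ concat) (map-tabulate (λ i → i) part) ⟩
    count P? (concat (tabulate part))        ≡⟨ count-concat-tabulate P? part ⟩
    ∑[ i < s ] count P? (part i)             ≡⟨ sum-cong-≋ (λ i → count-map P? (i ,_) (allFin (n i))) ⟩
    ∑[ i < s ] count (λ a → P? (i , a)) (allFin (n i)) ∎
    where open ≡-Reasoning

sameColour? : (G : FinGraph) {k : ℕ} (f : V G → Fin k) (u : V G) → Decidable (λ v → Adj G u v × f v ≡ f u)
sameColour? G f u v = adj? G u v ×-dec (f v ≟ f u)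

classSize : (G : FinGraph) {k : ℕ} → (V G → Fin k) → Fin k → ℕ
classSize G F d = count (λ v → F v ≟ d) (vs G)

class≤nbrs+nbrs : ∀ {s} {n : Fin s → ℕ} {k} (F : V (K s n) → Fin k) {v w} →
                  Adj (K s n) v w → F w ≡ F v →
                  classSize (K s n) F (F v) ≤ sameColourNbrs (K s n) F v + sameColourNbrs (K s n) F w
class≤nbrs+nbrs {s} {n} F {v} {w} v~w Fw≡Fv =
  count-⊆∪ _ (sameColour? G F v) (sameColour? G F w) neighbour (vs G)
  where
  G : FinGraph
  G = K s n
  -- a vertex not adjacent to v lies in the part of v, so it is adjacent to w
  neighbour : ∀ {u} → F u ≡ F v → (Adj G v u × F u ≡ F v) ⊎ (Adj G w u × F u ≡ F w)
  neighbour {u} Fu≡Fv with proj₁ v ≟ proj₁ u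
  ... | no  v~u             = inj₁ (v~u , Fu≡Fv)
  ... | yes v-u-same-part =
    inj₂ ((λ w-u-same-part → v~w (trans v-u-same-part (sym w-u-same-part))) , trans Fu≡Fv (sym Fw≡Fv))

dropColour : (G : FinGraph) {m : ℕ} (c : Fin (suc m)) (g : V G → Fin (suc m)) →
             (∀ v → g v ≢ c) → Relaxed3Colouring G (suc m) g → Colourable3 G m
dropColour G {m} c g g≢c g-valid = g′ , λ u → ≤-trans (count-mono _ _ (still-same u) (vs G)) (g-valid u)
  where
  g′ : V G → Fin m
  g′ v = punchOut (g≢c v ∘ sym)
  still-same : ∀ u {v} → Adj G u v × g′ v ≡ g′ u → Adj G u v × g v ≡ g u
  still-same u {v} (u~v , eq) = u~v , punchOut-injective (g≢c v ∘ sym) (g≢c u ∘ sym) eq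

-- In the application F is f restricted to H and slack d is the number of vertices of V_j coloured d.
module Recolouring
  (G : FinGraph) (∈-vs : ∀ v → v ∈ vs G) (vs-unique : Unique (vs G)) (irreflexive : ∀ v → ¬ Adj G v v)
  {m : ℕ} (F : V G → Fin (suc m)) (slack : Fin (suc m) → ℕ)
  (slack-bound : ∀ w → slack (F w) + sameColourNbrs G F w ≤ 3)
  (class-bound : ∀ d → 1 ≤ slack d → classSize G F d ≤ 3)
  where

  F-valid : Relaxed3Colouring G (suc m) F
  F-valid w = ≤-trans (m≤n+m _ _) (slack-bound w)

  Independent : Fin (suc m) → Set
  Independent d = ∀ {v w} → F v ≡ d → F w ≡ d → ¬ Adj G v w

  module SpreadClass
    (c : Fin (suc m)) (targets : List (Fin (suc m))) (targets-unique : Unique targets)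
    (targets≢c : All (_≢ c) targets) (targets-slack : All (λ d → 1 ≤ slack d) targets)
    (fits : classSize G F c ≤ length targets)
    where

    target : ∀ {v} → F v ≡ c → Fin (suc m)
    target {v} Fv≡c = lookup targets (inject≤ (index (∈-filter⁺ (λ u → F u ≟ c) (∈-vs v) Fv≡c)) fits)

    target-injective : ∀ {v w} (Fv≡c : F v ≡ c) (Fw≡c : F w ≡ c) → target Fv≡c ≡ target Fw≡c → v ≡ w
    target-injective _ _ = index-injective (setoid _) _ _ ∘ inject≤-injective _ _ _ _ ∘ lookup-injective targets-unique

    recolour : V G → Fin (suc m)
    recolour v with F v ≟ c
    ... | yes Fv≡c = target Fv≡c
    ... | no  _    = F v

    recolour-kept : ∀ {v} → F v ≢ c → recolour v ≡ F v
    recolour-kept {v} Fv≢c with F v ≟ c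
    ... | yes Fv≡c = contradiction Fv≡c Fv≢c
    ... | no  _    = refl

    recolour≢c : ∀ v → recolour v ≢ c
    recolour≢c v with F v ≟ c
    ... | yes _    = All.lookup targets≢c (∈-lookup _)
    ... | no  Fv≢c = Fv≢c

    recolour-slack : ∀ {v} → F v ≡ c → 1 ≤ slack (recolour v)
    recolour-slack {v} Fv≡c with F v ≟ c
    ... | yes _    = All.lookup targets-slack (∈-lookup _)
    ... | no  Fv≢c = contradiction Fv≡c Fv≢c

    recolour-injective : ∀ {v w} → F v ≡ c → F w ≡ c → recolour v ≡ recolour w → v ≡ w
    recolour-injective {v} {w} Fv≡c Fw≡c with F v ≟ c | F w ≟ c
    ... | yes Fv≡c′ | yes Fw≡c′ = target-injective Fv≡c′ Fw≡c′
    ... | no  Fv≢c  | _         = contradiction Fv≡c Fv≢c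
    ... | _         | no  Fw≢c  = contradiction Fw≡c Fw≢c

    movedInto : Fin (suc m) → ℕ
    movedInto d = count (λ v → (F v ≟ c) ×-dec (recolour v ≟ d)) (vs G)

    movedInto≤slack : ∀ d → movedInto d ≤ slack d
    movedInto≤slack d = m≤1⇒m≤n at-most-one positive
      where
      at-most-one : movedInto d ≤ 1
      at-most-one = count-≤1 _ (λ (Fx≡c , x↦d) (Fy≡c , y↦d) → recolour-injective Fx≡c Fy≡c (trans x↦d (sym y↦d)))
                             vs-unique
      positive : 1 ≤ movedInto d → 1 ≤ slack d
      positive pos with count-witness _ (vs G) pos
      ... | _ , Fv≡c , refl = recolour-slack Fv≡c

    valid-moved : ∀ {w} → F w ≡ c → sameColourNbrs G recolour w ≤ 3
    valid-moved {w} Fw≡c = ≤-trans (count-mono _ _ old-colour (vs G)) (class-bound _ (recolour-slack Fw≡c))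
      where
      old-colour : ∀ {v} → Adj G w v × recolour v ≡ recolour w → F v ≡ recolour w
      old-colour {v} (w~v , same) = case F v ≟ c of λ where
        (yes Fv≡c) → contradiction (subst (Adj G w) (recolour-injective Fv≡c Fw≡c same) w~v) (irreflexive w)
        (no  Fv≢c) → trans (sym (recolour-kept Fv≢c)) same

    valid-kept : ∀ {w} → F w ≢ c → sameColourNbrs G recolour w ≤ 3
    valid-kept {w} Fw≢c = begin
      sameColourNbrs G recolour w                  ≤⟨ count-⊆∪ _ _ _ old-or-moved (vs G) ⟩
      sameColourNbrs G F w + movedInto (F w)       ≤⟨ +-monoʳ-≤ _ (movedInto≤slack (F w)) ⟩
      sameColourNbrs G F w + slack (F w)           ≡⟨ +-comm _ (slack (F w)) ⟩
      slack (F w) + sameColourNbrs G F w           ≤⟨ slack-bound w ⟩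
      3                                            ∎
      where
      open ≤-Reasoning
      old-or-moved : ∀ {v} → Adj G w v × recolour v ≡ recolour w →
                     (Adj G w v × F v ≡ F w) ⊎ (F v ≡ c × recolour v ≡ F w)
      old-or-moved {v} (w~v , same) = case F v ≟ c of λ where
        (yes Fv≡c) → inj₂ (Fv≡c , trans same (recolour-kept Fw≢c))
        (no  Fv≢c) → inj₁ (w~v , trans (sym (recolour-kept Fv≢c)) (trans same (recolour-kept Fw≢c)))

    recolour-valid : Relaxed3Colouring G (suc m) recolour
    recolour-valid w = case F w ≟ c of λ where
      (yes Fw≡c) → valid-moved Fw≡c
      (no  Fw≢c) → valid-kept Fw≢c

    colourable : Colourable3 G m
    colourable = dropColour G c recolour recolour≢c recolour-valid

  module MergeClasses
    (c d : Fin (suc m)) (d≢c : d ≢ c) (c-independent : Independent c) (d-independent : Independent d)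
    (c-small : classSize G F c ≤ 3) (d-small : classSize G F d ≤ 3)
    where

    merge : V G → Fin (suc m)
    merge v with F v ≟ c
    ... | yes _ = d
    ... | no  _ = F v

    merge-moved : ∀ {v} → F v ≡ c → merge v ≡ d
    merge-moved {v} Fv≡c with F v ≟ c
    ... | yes _    = refl
    ... | no  Fv≢c = contradiction Fv≡c Fv≢c

    merge-kept : ∀ {v} → F v ≢ c → merge v ≡ F v
    merge-kept {v} Fv≢c with F v ≟ c
    ... | yes Fv≡c = contradiction Fv≡c Fv≢c
    ... | no  _    = refl

    merge≢c : ∀ v → merge v ≢ c
    merge≢c v with F v ≟ c
    ... | yes _    = d≢c
    ... | no  Fv≢c = Fv≢c

    valid-in-c : ∀ {w} → F w ≡ c → sameColourNbrs G merge w ≤ 3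
    valid-in-c {w} Fw≡c = ≤-trans (count-mono _ _ in-d (vs G)) d-small
      where
      in-d : ∀ {v} → Adj G w v × merge v ≡ merge w → F v ≡ d
      in-d {v} (w~v , same) = case F v ≟ c of λ where
        (yes Fv≡c) → contradiction w~v (c-independent Fw≡c Fv≡c)
        (no  Fv≢c) → trans (sym (merge-kept Fv≢c)) (trans same (merge-moved Fw≡c))

    valid-in-d : ∀ {w} → F w ≡ d → sameColourNbrs G merge w ≤ 3
    valid-in-d {w} Fw≡d = ≤-trans (count-mono _ _ in-c (vs G)) c-small
      where
      Fw≢c : F w ≢ c
      Fw≢c Fw≡c = d≢c (trans (sym Fw≡d) Fw≡c)
      in-c : ∀ {v} → Adj G w v × merge v ≡ merge w → F v ≡ c
      in-c {v} (w~v , same) = case F v ≟ c of λ where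
        (yes Fv≡c) → Fv≡c
        (no  Fv≢c) → contradiction w~v
          (d-independent Fw≡d (trans (sym (merge-kept Fv≢c)) (trans same (trans (merge-kept Fw≢c) Fw≡d))))

    valid-elsewhere : ∀ {w} → F w ≢ c → F w ≢ d → sameColourNbrs G merge w ≤ 3
    valid-elsewhere {w} Fw≢c Fw≢d = ≤-trans (count-mono _ _ old-colour (vs G)) (F-valid w)
      where
      old-colour : ∀ {v} → Adj G w v × merge v ≡ merge w → Adj G w v × F v ≡ F w
      old-colour {v} (w~v , same) = case F v ≟ c of λ where
        (yes Fv≡c) → contradiction (trans (sym (merge-moved Fv≡c)) (trans same (merge-kept Fw≢c))) (Fw≢d ∘ sym)
        (no  Fv≢c) → w~v , trans (sym (merge-kept Fv≢c)) (trans same (merge-kept Fw≢c))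

    merge-valid : Relaxed3Colouring G (suc m) merge
    merge-valid w = case ((F w ≟ c) , (F w ≟ d)) of λ where
      (yes Fw≡c , _)        → valid-in-c Fw≡c
      (no  Fw≢c , yes Fw≡d) → valid-in-d Fw≡d
      (no  Fw≢c , no  Fw≢d) → valid-elsewhere Fw≢c Fw≢d

    colourable : Colourable3 G m
    colourable = dropColour G c merge merge≢c merge-valid

module Deletion (t : ℕ) (n : Fin (suc t) → ℕ) (j : Fin (suc t)) where

  G H : FinGraph
  G = K (suc t) n
  H = K t (deletePart t n j)

  embed : V H → V G
  embed (i , a) = punchIn j i , a

  embed-injective : ∀ {v w} → embed v ≡ embed w → v ≡ w
  embed-injective {i , a} {i′ , a′} eq with punchIn-injective j i i′ (cong proj₁ eq)
  ... | refl with eq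
  ... | refl = refl

  count-split : ∀ {P : Pred (V G) 0ℓ} (P? : Decidable P) →
                count P? (vs G) ≡ count (λ a → P? (j , a)) (allFin (n j)) + count (P? ∘ embed) (vs H)
  count-split P? = begin
    count P? (vs G)                                                  ≡⟨ count-vertices P? ⟩
    ∑[ i < suc t ] perPart i                                         ≡⟨ sum-remove perPart ⟩
    perPart j + ∑[ i < t ] perPart (punchIn j i)                     ≡⟨ cong (perPart j +_) (count-vertices (P? ∘ embed)) ⟨
    count (λ a → P? (j , a)) (allFin (n j)) + count (P? ∘ embed) (vs H) ∎
    where
    open ≡-Reasoning
    perPart : Fin (suc t) → ℕ
    perPart i = count (λ a → P? (i , a)) (allFin (n i))

  preimage : ∀ {i} → i ≢ j → (a : Fin (n i)) → ∃ λ w → embed w ≡ (i , a)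
  preimage i≢j = onto (punchIn-punchOut (i≢j ∘ sym))
    where
    onto : ∀ {x i} → punchIn j x ≡ i → (a : Fin (n i)) → ∃ λ w → embed w ≡ (i , a)
    onto {x} refl a = (x , a) , refl

  data Located : V G → Set where
    inPart   : ∀ a → Located (j , a)
    embedded : ∀ w → Located (embed w)

  locate : ∀ v → Located v
  locate (i , a) with i ≟ j
  ... | yes refl = inPart a
  ... | no  i≢j  = let w , w↦v = preimage i≢j a in subst Located w↦v (embedded w)

  module AddPart {k : ℕ} (h : V H → Fin k) (h-valid : Relaxed3Colouring H k h) where

    extend : V G → Fin (suc k)
    extend (i , a) with i ≟ j
    ... | yes _   = fromℕ k
    ... | no  i≢j = inject₁ (h (proj₁ (preimage i≢j a)))

    extend-part : ∀ a → extend (j , a) ≡ fromℕ k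
    extend-part a with j ≟ j
    ... | yes _   = refl
    ... | no  j≢j = contradiction refl j≢j

    extend-embed : ∀ w → extend (embed w) ≡ inject₁ (h w)
    extend-embed (i , a) with punchIn j i ≟ j
    ... | yes ↑i≡j = contradiction ↑i≡j (punchInᵢ≢i j i)
    ... | no  ↑i≢j = cong (inject₁ ∘ h) (embed-injective (proj₂ (preimage ↑i≢j a)))

    extend-valid : Relaxed3Colouring G (suc k) extend
    extend-valid u with locate u
    ... | inPart a = ≤-trans (≤-reflexive (count-≡0 _ no-neighbour (vs G))) z≤n
      where
      no-neighbour : ∀ v → ¬ (Adj G (j , a) v × extend v ≡ extend (j , a))
      no-neighbour v (j~v , same) with locate v
      ... | inPart _   = j~v refl
      ... | embedded w = fromℕ≢inject₁ (trans (sym (extend-part a)) (trans (sym same) (extend-embed w)))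
    ... | embedded w = begin
      sameColourNbrs G extend (embed w)                                    ≡⟨ count-split same? ⟩
      count (same? ∘ (j ,_)) (allFin (n j)) + count (same? ∘ embed) (vs H) ≡⟨ cong (_+ count (same? ∘ embed) (vs H))
                                                                                   (count-≡0 _ old-colour (allFin (n j))) ⟩
      count (same? ∘ embed) (vs H)                                         ≤⟨ count-mono _ _ restrict (vs H) ⟩
      sameColourNbrs H h w                                                 ≤⟨ h-valid w ⟩
      3                                                                    ∎
      where
      open ≤-Reasoning
      same? : Decidable (λ v → Adj G (embed w) v × extend v ≡ extend (embed w))
      same? = sameColour? G extend (embed w)
      old-colour : ∀ a → ¬ (Adj G (embed w) (j , a) × extend (j , a) ≡ extend (embed w))
      old-colour a (_ , same) = fromℕ≢inject₁ (trans (sym (extend-part a)) (trans same (extend-embed w)))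
      restrict : ∀ {w′} → Adj G (embed w) (embed w′) × extend (embed w′) ≡ extend (embed w) →
                 Adj H w w′ × h w′ ≡ h w
      restrict {w′} (↑w~↑w′ , same) =
        ↑w~↑w′ ∘ cong (punchIn j) ,
        inject₁-injective (trans (sym (extend-embed w′)) (trans same (extend-embed w)))

    colourable : Colourable3 G (suc k)
    colourable = extend , extend-valid

module Removal (t : ℕ) (n : Fin (suc t) → ℕ) (j : Fin (suc t)) {m : ℕ}
               (f : V (K (suc t) n) → Fin (suc m)) (f-valid : Relaxed3Colouring (K (suc t) n) (suc m) f)
  where

  open Deletion t n j

  F : V H → Fin (suc m)
  F = f ∘ embed

  partColour : Fin (n j) → Fin (suc m)
  partColour a = f (j , a)

  slack : Fin (suc m) → ℕ
  slack d = count (λ a → partColour a ≟ d) (allFin (n j))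

  slack-partColour : ∀ a → 1 ≤ slack (partColour a)
  slack-partColour a = count-pos _ (∈-allFin a) refl

  class-bound : ∀ d → 1 ≤ slack d → classSize H F d ≤ 3
  class-bound d pos with count-witness _ (allFin (n j)) pos
  ... | a , refl = begin
    classSize H F (partColour a)                                         ≤⟨ count-mono _ _ adjacent (vs H) ⟩
    count (same? ∘ embed) (vs H)                                         ≤⟨ m≤n+m _ _ ⟩
    count (same? ∘ (j ,_)) (allFin (n j)) + count (same? ∘ embed) (vs H) ≡⟨ count-split same? ⟨
    sameColourNbrs G f (j , a)                                           ≤⟨ f-valid (j , a) ⟩
    3                                                                    ∎
    where
    open ≤-Reasoning
    same? : Decidable (λ v → Adj G (j , a) v × f v ≡ f (j , a))
    same? = sameColour? G f (j , a)
    adjacent : ∀ {w} → F w ≡ partColour a → Adj G (j , a) (embed w) × F w ≡ partColour a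
    adjacent {i , _} Fw≡ = punchInᵢ≢i j i ∘ sym , Fw≡

  slack-bound : ∀ w → slack (F w) + sameColourNbrs H F w ≤ 3
  slack-bound w@(i , _) = begin
    slack (F w) + sameColourNbrs H F w                                   ≤⟨ +-mono-≤ (count-mono _ _ from-part (allFin (n j)))
                                                                                     (count-mono _ _ from-H (vs H)) ⟩
    count (same? ∘ (j ,_)) (allFin (n j)) + count (same? ∘ embed) (vs H) ≡⟨ count-split same? ⟨
    sameColourNbrs G f (embed w)                                         ≤⟨ f-valid (embed w) ⟩
    3                                                                    ∎
    where
    open ≤-Reasoning
    same? : Decidable (λ v → Adj G (embed w) v × f v ≡ F w)
    same? = sameColour? G f (embed w)
    from-part : ∀ {a} → partColour a ≡ F w → Adj G (embed w) (j , a) × f (j , a) ≡ F w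
    from-part same = punchInᵢ≢i j i , same
    from-H : ∀ {w′} → Adj H w w′ × F w′ ≡ F w → Adj G (embed w) (embed w′) × F w′ ≡ F w
    from-H (w~w′ , same) = w~w′ ∘ punchIn-injective j _ _ , same

  open Recolouring H ∈-vertices vertices-unique (λ _ v~v → v~v refl) F slack slack-bound class-bound

  slack≤3 : ∀ d → 1 ≤ classSize H F d → slack d ≤ 3
  slack≤3 d pos with count-witness _ (vs H) pos
  ... | w , refl = ≤-trans (m≤m+n _ _) (slack-bound w)

  independent : ∀ d → 7 ≤ slack d + slack d + classSize H F d → Independent d
  independent d 7≤ {v} {w} refl Fw≡Fv v~w = <⇒≱ 7≤ (begin
    σ + σ + classSize H F (F v)     ≤⟨ +-monoʳ-≤ (σ + σ) (class≤nbrs+nbrs F v~w Fw≡Fv) ⟩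
    σ + σ + (nbrs v + nbrs w)       ≡⟨ interchange σ σ (nbrs v) (nbrs w) ⟩
    (σ + nbrs v) + (σ + nbrs w)     ≤⟨ +-mono-≤ (slack-bound v)
                                                (subst (λ d → slack d + nbrs w ≤ 3) Fw≡Fv (slack-bound w)) ⟩
    6                               ∎)
    where
    open ≤-Reasoning
    σ : ℕ
    σ = slack (F v)
    nbrs : V H → ℕ
    nbrs = sameColourNbrs H F

  spreadOnto : ∀ c (as : List (Fin (n j))) → Unique (map partColour as) → All (λ a → partColour a ≢ c) as →
               classSize H F c ≤ length as → Colourable3 H m
  spreadOnto c as unique ≢c fits =
    SpreadClass.colourable c (map partColour as) unique (All-map⁺ ≢c) (All-map⁺ (universal slack-partColour as))
                           (≤-trans fits (≤-reflexive (sym (length-map partColour as))))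

  mergeOnto : ∀ a a′ → partColour a′ ≢ partColour a →
              7 ≤ slack (partColour a) + slack (partColour a) + classSize H F (partColour a) →
              7 ≤ slack (partColour a′) + slack (partColour a′) + classSize H F (partColour a′) →
              Colourable3 H m
  mergeOnto a a′ c′≢c crowded crowded′ =
    MergeClasses.colourable _ _ c′≢c (independent _ crowded) (independent _ crowded′)
                            (class-bound _ (slack-partColour a)) (class-bound _ (slack-partColour a′))

  n≤count : ∀ {P : Pred (Fin (suc m)) 0ℓ} (P? : Decidable P) → (∀ a → P (partColour a)) →
            n j ≤ count (P? ∘ partColour) (allFin (n j))
  n≤count P? all-P = begin
    n j                                          ≡⟨ length-tabulate (λ a → a) ⟨
    length (allFin (n j))                        ≡⟨ count-U (allFin (n j)) ⟨
    count U? (allFin (n j))                      ≤⟨ count-mono U? _ (λ {a} _ → all-P a) (allFin (n j)) ⟩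
    count (P? ∘ partColour) (allFin (n j))       ∎
    where open ≤-Reasoning

  module Selection (6≤nj : 6 ≤ n j) where

    a₀ : Fin (n j)
    a₀ = inject≤ Fin.zero 6≤nj

    c₀ : Fin (suc m)
    c₀ = partColour a₀

    oneColour : (∀ a → partColour a ≡ c₀) → Colourable3 H m
    oneColour monochrome with classSize H F c₀ ≤? 0
    ... | yes empty    = spreadOnto c₀ [] [] [] empty
    ... | no  nonempty = ⊥-elim (6≰5 (≤-trans 6≤slack (≤-trans (slack≤3 c₀ (≰⇒> nonempty)) (m≤n+m 3 2))))
      where
      6≤slack : 6 ≤ slack c₀
      6≤slack = ≤-trans 6≤nj (n≤count (_≟ c₀) monochrome)

    module _ (a₁ : Fin (n j)) (c₁≢c₀ : partColour a₁ ≢ c₀) where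

      c₁ : Fin (suc m)
      c₁ = partColour a₁

      twoColours : (∀ a → partColour a ≡ c₀ ⊎ partColour a ≡ c₁) → Colourable3 H m
      twoColours cover with classSize H F c₀ ≤? 1 | classSize H F c₁ ≤? 1
      ... | yes small₀ | _          = spreadOnto c₀ (a₁ ∷ []) ([] ∷ []) (c₁≢c₀ ∷ []) small₀
      ... | no  _      | yes small₁ = spreadOnto c₁ (a₀ ∷ []) ([] ∷ []) ((c₁≢c₀ ∘ sym) ∷ []) small₁
      ... | no  large₀ | no  large₁ = mergeOnto a₀ a₁ c₁≢c₀ (crowded slack₀ large₀) (crowded slack₁ large₁)
        where
        6≤slacks : 6 ≤ slack c₀ + slack c₁
        6≤slacks = ≤-trans 6≤nj (≤-trans (n≤count ((_≟ c₀) ∪? (_≟ c₁)) cover) (count-∪ _ _ (allFin (n j))))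
        slack₀ : 3 ≤ slack c₀
        slack₀ = 6≤m+n⇒n≤3⇒3≤m 6≤slacks (slack≤3 c₁ (≤-trans (s≤s z≤n) (≰⇒> large₁)))
        slack₁ : 3 ≤ slack c₁
        slack₁ = 6≤m+n⇒n≤3⇒3≤m (subst (6 ≤_) (+-comm (slack c₀) _) 6≤slacks)
                                (slack≤3 c₀ (≤-trans (s≤s z≤n) (≰⇒> large₀)))
        crowded : ∀ {d} → 3 ≤ slack d → ¬ classSize H F d ≤ 1 → 7 ≤ slack d + slack d + classSize H F d
        crowded 3≤s large = ≤-trans (n≤1+n 7) (+-mono-≤ (+-mono-≤ 3≤s 3≤s) (≰⇒> large))

      module _ (a₂ : Fin (n j)) (c₂≢c₀ : partColour a₂ ≢ c₀) (c₂≢c₁ : partColour a₂ ≢ c₁) where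

        c₂ : Fin (suc m)
        c₂ = partColour a₂

        fourColours : ∀ a₃ → partColour a₃ ≢ c₀ → partColour a₃ ≢ c₁ → partColour a₃ ≢ c₂ → Colourable3 H m
        fourColours a₃ c₃≢c₀ c₃≢c₁ c₃≢c₂ =
          spreadOnto c₀ (a₁ ∷ a₂ ∷ a₃ ∷ [])
                     (((c₂≢c₁ ∘ sym) ∷ (c₃≢c₁ ∘ sym) ∷ []) ∷ ((c₃≢c₂ ∘ sym) ∷ []) ∷ [] ∷ [])
                     (c₁≢c₀ ∷ c₂≢c₀ ∷ c₃≢c₀ ∷ []) (class-bound c₀ (slack-partColour a₀))

        crowded : ∀ {d} → 2 ≤ slack d → 3 ≤ classSize H F d → 7 ≤ slack d + slack d + classSize H F d
        crowded 2≤s 3≤B = +-mono-≤ (+-mono-≤ 2≤s 2≤s) 3≤B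

        threeLargeClasses : (∀ a → partColour a ≡ c₀ ⊎ partColour a ≡ c₁ ⊎ partColour a ≡ c₂) →
                            3 ≤ classSize H F c₀ → 3 ≤ classSize H F c₁ → 3 ≤ classSize H F c₂ → Colourable3 H m
        threeLargeClasses cover large₀ large₁ large₂
          with two-of-three 6≤slacks (slack≤3′ large₀) (slack≤3′ large₁) (slack≤3′ large₂)
          where
          6≤slacks : 6 ≤ slack c₀ + (slack c₁ + slack c₂)
          6≤slacks = ≤-trans 6≤nj (≤-trans (n≤count ((_≟ c₀) ∪? (_≟ c₁) ∪? (_≟ c₂)) cover)
                       (≤-trans (count-∪ _ _ (allFin (n j))) (+-monoʳ-≤ (slack c₀) (count-∪ _ _ (allFin (n j))))))
          slack≤3′ : ∀ {d} → 3 ≤ classSize H F d → slack d ≤ 3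
          slack≤3′ large = slack≤3 _ (≤-trans (s≤s z≤n) large)
        ... | inj₁ (s₀ , s₁)        = mergeOnto a₀ a₁ c₁≢c₀ (crowded s₀ large₀) (crowded s₁ large₁)
        ... | inj₂ (inj₁ (s₀ , s₂)) = mergeOnto a₀ a₂ c₂≢c₀ (crowded s₀ large₀) (crowded s₂ large₂)
        ... | inj₂ (inj₂ (s₁ , s₂)) = mergeOnto a₁ a₂ c₂≢c₁ (crowded s₁ large₁) (crowded s₂ large₂)

        threeColours : (∀ a → partColour a ≡ c₀ ⊎ partColour a ≡ c₁ ⊎ partColour a ≡ c₂) → Colourable3 H m
        threeColours cover with classSize H F c₀ ≤? 2 | classSize H F c₁ ≤? 2 | classSize H F c₂ ≤? 2
        ... | yes small₀ | _          | _          =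
          spreadOnto c₀ (a₁ ∷ a₂ ∷ []) (((c₂≢c₁ ∘ sym) ∷ []) ∷ [] ∷ []) (c₁≢c₀ ∷ c₂≢c₀ ∷ []) small₀
        ... | no _       | yes small₁ | _          =
          spreadOnto c₁ (a₀ ∷ a₂ ∷ []) (((c₂≢c₀ ∘ sym) ∷ []) ∷ [] ∷ []) ((c₁≢c₀ ∘ sym) ∷ c₂≢c₁ ∷ []) small₁
        ... | no _       | no _       | yes small₂ =
          spreadOnto c₂ (a₀ ∷ a₁ ∷ []) (((c₁≢c₀ ∘ sym) ∷ []) ∷ [] ∷ [])
                     ((c₂≢c₀ ∘ sym) ∷ (c₂≢c₁ ∘ sym) ∷ []) small₂
        ... | no large₀  | no large₁  | no large₂  = threeLargeClasses cover (≰⇒> large₀) (≰⇒> large₁) (≰⇒> large₂)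

    colourable : Colourable3 H m
    colourable with any? (λ a → ¬? (partColour a ≟ c₀))
    ... | no none = oneColour (λ a → decidable-stable (partColour a ≟ c₀) (λ c≢c₀ → none (a , c≢c₀)))
    ... | yes (a₁ , c₁≢c₀)
          with any? (λ a → ¬? (partColour a ≟ c₀) ×-dec ¬? (partColour a ≟ partColour a₁))
    ...   | no none = twoColours a₁ c₁≢c₀ λ a →
            dec-⊎ (partColour a ≟ c₀) (partColour a ≟ partColour a₁) (λ ¬both → none (a , ¬both))
    ...   | yes (a₂ , c₂≢c₀ , c₂≢c₁)
            with any? (λ a → ¬? (partColour a ≟ c₀) ×-dec ¬? (partColour a ≟ partColour a₁)
                                                     ×-dec ¬? (partColour a ≟ partColour a₂))
    ...     | yes (a₃ , c₃≢c₀ , c₃≢c₁ , c₃≢c₂) =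
              fourColours a₁ c₁≢c₀ a₂ c₂≢c₀ c₂≢c₁ a₃ c₃≢c₀ c₃≢c₁ c₃≢c₂
    ...     | no none = threeColours a₁ c₁≢c₀ a₂ c₂≢c₀ c₂≢c₁ λ a →
              dec-⊎ (partColour a ≟ c₀) ((partColour a ≟ partColour a₁) ⊎-dec (partColour a ≟ partColour a₂))
                    (λ (c≢c₀ , ¬rest) → none (a , c≢c₀ , ¬rest ∘ inj₁ , ¬rest ∘ inj₂))

removePart : ∀ t (n : Fin (suc t) → ℕ) j {m} → 6 ≤ n j →
             Colourable3 (K (suc t) n) (suc m) → Colourable3 (K t (deletePart t n j)) m
removePart t n j 6≤nj (f , f-valid) = Removal.Selection.colourable t n j f f-valid 6≤nj

corollary5p2 : (t : ℕ) → 1 ≤ t → (n : Fin (suc t) → ℕ) → (j : Fin (suc t)) →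
    6 ≤ n j → (k : ℕ) → IsChi3 (K t (deletePart t n j)) k →
    IsChi3 (K (suc t) n) (suc k)
corollary5p2 t _ n j 6≤nj k ((h , h-valid) , minimal) = Deletion.AddPart.colourable t n j h h-valid , fewer
  where
  fewer : ∀ m → m < suc k → ¬ Colourable3 (K (suc t) n) m
  fewer zero    _         (f , _)   = ¬Fin0 (f (j , inject≤ Fin.zero 6≤nj))
  fewer (suc m) (s≤s m<k) colouring = minimal m m<k (removePart t n j 6≤nj colouring)
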